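{- Let $I$ be a model of a simple program $\mathcal H$, and let $K$ be a set of atoms such that there are no FLP-critical edges in the subgraph of the dependency graph of $\mathcal H$ induced by $K$. If $I\models(\mathcal H^+)^K_\bot$, then $I\setminus K$ satisfies the FT-reduct $FT(\mathcal H,I)$.
   Context: Infinitary propositional formulas: atoms, arbitrary conjunctions $\mathcal H^\land$, disjunctions $\mathcal H^\lor$, implications; $\top=\emptyset^\land$, $\bot=\emptyset^\lor$, $\neg F=F\to\bot$; interpretations are sets of atoms with the usual satisfaction. FT-reduct: $FT(p,I)=p$ if $p\in I$, else $\bot$; $FT(\mathcal H^\land,I)=\{FT(F,I):F\in\mathcal H\}^\land$, likewise for $\lor$; $FT(F\to F',I)=\bot$ if $I\not\models F\to F'$, else $FT(F,I)\to FT(F',I)$; for a set of formulas it is applied elementwise. Extended literals: $p,\neg p,\neg\neg p$. A simple disjunction is a disjunction of extended literals; a simple implication is $\mathcal A^\land\to\mathcal L^\lor$ with $\mathcal A$ a set of atoms and $\mathcal L^\lor$ a simple disjunction; a simple formula is a conjunction of simple implications; a simple rule is $G\to H$ with $G$ a simple formula and $H$ a disjunction of atoms; a simple program is a set of simple rules. An atom $q$ occurs positively in $G$ if $q$ or $\neg\neg q$ belongs to $\mathcal L$ for some conjunctive term $\mathcal A^\land\to\mathcal L^\lor$ of $G$. The dependency graph of $\mathcal H$ has the atoms of $\mathcal H$ as vertices and an edge $p\to q$ if for some $G\to H\in\mathcal H$, $p$ is a disjunctive term of $H$ and $q$ occurs positively in $G$; the edge is FLP-critical if for some $G\to H\in\mathcal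 H$, $p$ is a disjunctive term of $H$ and $\neg\neg q\in\mathcal L$ for some conjunctive term $\mathcal A^\land\to\mathcal L^\lor$ of $G$. $F^+$ denotes the result of replacing each extended literal $\neg\neg p$ in $F$ by $p$ (for simple disjunctions, implications, formulas, rules, programs). For a set $X$ of atoms: for a simple disjunction $F$, $F^X_\bot$ removes all disjunctive terms belonging to $X$; for a simple implication $F=\mathcal A^\land\to\mathcal L^\lor$, $F^X_\bot$ is $F$ if $\mathcal A\cap X\ne\emptyset$ and $\mathcal A^\land\to(\mathcal L^\lor)^X_\bot$ otherwise; termwise for simple formulas; for a simple program, each $G\to H$ is replaced by $G^X_\bot\to H^X_\bot$. -}

module Defs where

open import Level using (0ℓ)
open import Data.Empty using (⊥)
open import Data.Sum using (_⊎_)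
open import Data.Product using (Σ; ∃; _×_; _,_; proj₁)
open import Relation.Nullary using (¬_; yes; no)
open import Relation.Unary using (Pred)
open import Relation.Binary.PropositionalEquality using (_≡_)
open import Axiom.ExcludedMiddle using (ExcludedMiddle)

-- Classical logic is assumed as an explicit parameter (LEM), needed to
-- define FT-reducts and the reduct F^X_⊥ by the case distinctions of the paper.
LEM : Set₁
LEM = ExcludedMiddle 0ℓ

-- Infinitary propositional formulas over a type A of atoms.
-- A set ℋ of formulas is given as an indexed family  X → Formula A.

data Formula (A : Set) : Set₁ where
  atom : A → Formula A
  ⋀    : {X : Set} → (X → Formula A) → Formula A
  ⋁    : {X : Set} → (X → Formula A) → Formula A
  _⇒_  : Formula A → Formula A → Formula A

module _ {A : Set} where

  ⊤ᶠ : Formula A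
  ⊤ᶠ = ⋀ {X = ⊥} (λ ())

  ⊥ᶠ : Formula A
  ⊥ᶠ = ⋁ {X = ⊥} (λ ())

  ¬ᶠ : Formula A → Formula A
  ¬ᶠ F = F ⇒ ⊥ᶠ

Interp : Set → Set₁
Interp A = Pred A 0ℓ

infix 4 _⊨_
_⊨_ : {A : Set} → Interp A → Formula A → Set
I ⊨ atom p = I p
I ⊨ ⋀ {X} f = (x : X) → I ⊨ f x
I ⊨ ⋁ {X} f = Σ X (λ x → I ⊨ f x)
I ⊨ (F ⇒ G) = I ⊨ F → I ⊨ G

_∖_ : {A : Set} → Interp A → Pred A 0ℓ → Interp A
(I ∖ K) a = I a × ¬ K a

FT : {A : Set} → LEM → Formula A → Interp A → Formula A
FT lem (atom p) I with lem {I p}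
... | yes _ = atom p
... | no  _ = ⊥ᶠ
FT lem (⋀ f) I = ⋀ (λ x → FT lem (f x) I)
FT lem (⋁ f) I = ⋁ (λ x → FT lem (f x) I)
FT lem (F ⇒ G) I with lem {I ⊨ (F ⇒ G)}
... | yes _ = FT lem F I ⇒ FT lem G I
... | no  _ = ⊥ᶠ

data ExtLit (A : Set) : Set where
  pos    : A → ExtLit A
  neg    : A → ExtLit A
  negneg : A → ExtLit A

-- A simple disjunction is given by its set 𝓛 of extended literals;
-- a simple implication 𝓐^∧ → 𝓛^∨ by the sets 𝓐 and 𝓛.
record SimpleImp (A : Set) : Set₁ where
  constructor _⟶_
  field
    body : Pred A 0ℓ
    head : Pred (ExtLit A) 0ℓ

-- A simple formula: a conjunction of a set (indexed family) of simple implications.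
record SimpleFormula (A : Set) : Set₁ where
  field
    Idx  : Set
    term : Idx → SimpleImp A

-- A simple rule G → H, H a disjunction of the set of atoms `head`.
record SimpleRule (A : Set) : Set₁ where
  field
    body : SimpleFormula A
    head : Pred A 0ℓ

record SimpleProgram (A : Set) : Set₁ where
  field
    Idx  : Set
    rule : Idx → SimpleRule A

open SimpleImp
open SimpleFormula
open SimpleRule
open SimpleProgram

module _ {A : Set} where

  litF : ExtLit A → Formula A
  litF (pos p)    = atom p
  litF (neg p)    = ¬ᶠ (atom p)
  litF (negneg p) = ¬ᶠ (¬ᶠ (atom p))

  disjF : Pred (ExtLit A) 0ℓ → Formula A
  disjF L = ⋁ {X = Σ (ExtLit A) L} (λ x → litF (proj₁ x))

  atomsF∧ : Pred A 0ℓ → Formula A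
  atomsF∧ S = ⋀ {X = Σ A S} (λ x → atom (proj₁ x))

  atomsF∨ : Pred A 0ℓ → Formula A
  atomsF∨ S = ⋁ {X = Σ A S} (λ x → atom (proj₁ x))

  impF : SimpleImp A → Formula A
  impF F = atomsF∧ (body F) ⇒ disjF (head F)

  formF : SimpleFormula A → Formula A
  formF G = ⋀ (λ i → impF (term G i))

  ruleF : SimpleRule A → Formula A
  ruleF r = formF (body r) ⇒ atomsF∨ (head r)

  _⊨ₚ_ : Interp A → SimpleProgram A → Set
  I ⊨ₚ Π = (i : Idx Π) → I ⊨ ruleF (rule Π i)

  FTₚ : LEM → (Π : SimpleProgram A) → Interp A → Idx Π → Formula A
  FTₚ lem Π I i = FT lem (ruleF (rule Π i)) I

  _⊨ₛ_ : {X : Set} → Interp A → (X → Formula A) → Set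
  J ⊨ₛ ℋ = ∀ x → J ⊨ ℋ x

  OccursPos : A → SimpleFormula A → Set
  OccursPos q G = Σ (Idx G) (λ j → head (term G j) (pos q) ⊎ head (term G j) (negneg q))

  Edge : SimpleProgram A → A → A → Set
  Edge Π p q = Σ (Idx Π) (λ i → head (rule Π i) p × OccursPos q (body (rule Π i)))

  FLPCritical : SimpleProgram A → A → A → Set
  FLPCritical Π p q =
    Σ (Idx Π) (λ i → head (rule Π i) p ×
      Σ (Idx (body (rule Π i))) (λ j → head (term (body (rule Π i)) j) (negneg q)))

  NoFLPCriticalIn : SimpleProgram A → Pred A 0ℓ → Set
  NoFLPCriticalIn Π K = ∀ p q → K p → K q → Edge Π p q → ¬ FLPCritical Π p q

  litPlus : ExtLit A → ExtLit A
  litPlus (pos p)    = pos p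
  litPlus (neg p)    = neg p
  litPlus (negneg p) = pos p

  disjPlus : Pred (ExtLit A) 0ℓ → Pred (ExtLit A) 0ℓ
  disjPlus L l = Σ (ExtLit A) (λ l′ → L l′ × litPlus l′ ≡ l)

  impPlus : SimpleImp A → SimpleImp A
  impPlus F = body F ⟶ disjPlus (head F)

  formPlus : SimpleFormula A → SimpleFormula A
  formPlus G = record { Idx = Idx G ; term = λ j → impPlus (term G j) }

  rulePlus : SimpleRule A → SimpleRule A
  rulePlus r = record { body = formPlus (body r) ; head = head r }

  progPlus : SimpleProgram A → SimpleProgram A
  progPlus Π = record { Idx = Idx Π ; rule = λ i → rulePlus (rule Π i) }

  LitIn : Pred A 0ℓ → ExtLit A → Set
  LitIn X (pos p)    = X p
  LitIn X (neg p)    = ⊥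
  LitIn X (negneg p) = ⊥

  disj⊥ : Pred A 0ℓ → Pred (ExtLit A) 0ℓ → Pred (ExtLit A) 0ℓ
  disj⊥ X L l = L l × ¬ LitIn X l

  atoms⊥ : Pred A 0ℓ → Pred A 0ℓ → Pred A 0ℓ
  atoms⊥ X H a = H a × ¬ X a

  imp⊥ : LEM → Pred A 0ℓ → SimpleImp A → SimpleImp A
  imp⊥ lem X F with lem {Σ A (λ a → body F a × X a)}
  ... | yes _ = F
  ... | no  _ = body F ⟶ disj⊥ X (head F)

  form⊥ : LEM → Pred A 0ℓ → SimpleFormula A → SimpleFormula A
  form⊥ lem X G = record { Idx = Idx G ; term = λ j → imp⊥ lem X (term G j) }

  rule⊥ : LEM → Pred A 0ℓ → SimpleRule A → SimpleRule A
  rule⊥ lem X r = record { body = form⊥ lem X (body r) ; head = atoms⊥ X (head r) }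

  prog⊥ : LEM → Pred A 0ℓ → SimpleProgram A → SimpleProgram A
  prog⊥ lem X Π = record { Idx = Idx Π ; rule = λ i → rule⊥ lem X (rule Π i) }

-- Write J = I ∖ K and take a rule G → H of ℋ. Since I ⊨ G → H, its FT-reduct is
-- FT(G, I) → FT(H, I); assume J ⊨ FT(G, I), so that I ⊨ G, and suppose no head
-- atom lies in J. Then I ⊨ H yields a head atom p ∈ I ∩ K, and as p → q is an
-- edge for every ¬¬q in G, the absence of FLP-critical edges inside K keeps all
-- such q outside K. This makes every term of G satisfied in I after passing to
-- (·⁺)^K_⊥: a term whose body meets K is only weakened by ⁺, and a term whose
-- body avoids K has its body in J, so J ⊨ FT(G, I) supplies a literal that
-- survives the reduct. Hence I ⊨ (H)^K_⊥, a head atom in J after all.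
module Submission where

open import Defs
open import Level using (0ℓ)
open import Relation.Unary using (Pred; _⊆_)
open import Data.Empty using (⊥-elim)
open import Data.Sum using (inj₂)
open import Data.Product using (Σ; _×_; _,_; proj₁)
open import Relation.Nullary using (¬_; yes; no)
open import Relation.Binary.PropositionalEquality using (refl)
open import Axiom.DoubleNegationElimination using (em⇒dne)
open SimpleImp
open SimpleFormula
open SimpleRule
open SimpleProgram

module _ (lem : LEM) {A : Set} {I J : Interp A} where

  FT-sound : (F : Formula A) → J ⊨ FT lem F I → I ⊨ F
  FT-sound (atom p) h with lem {I p}
  ... | yes p∈I = p∈I
  ... | no _    = ⊥-elim (proj₁ h)
  FT-sound (⋀ f) h       = λ x → FT-sound (f x) (h x)
  FT-sound (⋁ f) (x , h) = x , FT-sound (f x) h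
  FT-sound (F ⇒ G) h with lem {I ⊨ (F ⇒ G)}
  ... | yes I⊨F⇒G = I⊨F⇒G
  ... | no _      = ⊥-elim (proj₁ h)

  FT-atom⁻ : (p : A) → J ⊨ FT lem (atom p) I → J p
  FT-atom⁻ p h with lem {I p}
  ... | yes _ = h
  ... | no _  = ⊥-elim (proj₁ h)

  FT-atom⁺ : J ⊆ I → (p : A) → J p → J ⊨ FT lem (atom p) I
  FT-atom⁺ J⊆I p p∈J with lem {I p}
  ... | yes _  = p∈J
  ... | no p∉I = ⊥-elim (p∉I (J⊆I p∈J))

  FT-⇒⁻ : (F G : Formula A) → J ⊨ FT lem (F ⇒ G) I → J ⊨ FT lem F I → J ⊨ FT lem G I
  FT-⇒⁻ F G h with lem {I ⊨ (F ⇒ G)}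
  ... | yes _ = h
  ... | no _  = ⊥-elim (proj₁ h)

  FT-⇒⁺ : (F G : Formula A) → I ⊨ (F ⇒ G) →
          (J ⊨ FT lem F I → J ⊨ FT lem G I) → J ⊨ FT lem (F ⇒ G) I
  FT-⇒⁺ F G I⊨F⇒G h with lem {I ⊨ (F ⇒ G)}
  ... | yes _     = h
  ... | no I⊭F⇒G = ⊥-elim (I⊭F⇒G I⊨F⇒G)

  FT-atomsF∧⁺ : J ⊆ I → {S : Pred A 0ℓ} → S ⊆ J → J ⊨ FT lem (atomsF∧ S) I
  FT-atomsF∧⁺ J⊆I S⊆J (a , a∈S) = FT-atom⁺ J⊆I a (S⊆J a∈S)

  FT-atomsF∨⁺ : J ⊆ I → {S : Pred A 0ℓ} {p : A} → S p → J p → J ⊨ FT lem (atomsF∨ S) I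
  FT-atomsF∨⁺ J⊆I {p = p} p∈S p∈J = (p , p∈S) , FT-atom⁺ J⊆I p p∈J

module _ (lem : LEM) {A : Set} (I : Interp A) where

  litF-litPlus : (l : ExtLit A) → I ⊨ litF l → I ⊨ litF (litPlus l)
  litF-litPlus (pos p)    h = h
  litF-litPlus (neg p)    h = h
  litF-litPlus (negneg p) h = em⇒dne lem λ p∉I → proj₁ (h λ p∈I → ⊥-elim (p∉I p∈I))

  impF-impPlus : (T : SimpleImp A) → I ⊨ impF T → I ⊨ impF (impPlus T)
  impF-impPlus T I⊨T I⊨body with I⊨T I⊨body
  ... | (l , l∈L) , I⊨l = (litPlus l , l , l∈L , refl) , litF-litPlus l I⊨l

  impF-imp⊥ : (K : Pred A 0ℓ) (T : SimpleImp A) → I ⊨ impF T →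
              (¬ Σ A (λ a → body T a × K a) → I ⊨ impF (body T ⟶ disj⊥ K (head T))) →
              I ⊨ impF (imp⊥ lem K T)
  impF-imp⊥ K T I⊨T I⊨T⊥ with lem {Σ A (λ a → body T a × K a)}
  ... | yes _          = I⊨T
  ... | no body∩K≡∅ = I⊨T⊥ body∩K≡∅

noFLPCritical⇒negneg∉K : {A : Set} (Π : SimpleProgram A) {K : Pred A 0ℓ} → NoFLPCriticalIn Π K →
  ∀ i {p} → head (rule Π i) p → K p →
  ∀ j q → head (term (body (rule Π i)) j) (negneg q) → ¬ K q
noFLPCritical⇒negneg∉K Π noFLP i {p} p∈H p∈K j q q∈L q∈K =
  noFLP p q p∈K q∈K (i , p∈H , j , inj₂ q∈L) (i , p∈H , j , q∈L)

module _ (lem : LEM) {A : Set} {I K : Interp A} where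

  litF-reduct : (L : Pred (ExtLit A) 0ℓ) → (∀ q → L (negneg q) → ¬ K q) →
                (l : ExtLit A) → L l → (I ∖ K) ⊨ FT lem (litF l) I →
                I ⊨ disjF (disj⊥ K (disjPlus L))
  litF-reduct L nc (pos q) l∈L h with FT-atom⁻ lem q h
  ... | q∈I , q∉K = (pos q , (pos q , l∈L , refl) , q∉K) , q∈I
  litF-reduct L nc (neg q) l∈L h =
    (neg q , (neg q , l∈L , refl) , λ ()) , FT-sound lem (litF (neg q)) h
  litF-reduct L nc (negneg q) l∈L h =
    (pos q , (negneg q , l∈L , refl) , nc q l∈L) ,
    litF-litPlus lem I (negneg q) (FT-sound lem (litF (negneg q)) h)

  impF-reduct : (T : SimpleImp A) → (∀ q → head T (negneg q) → ¬ K q) →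
                I ⊨ impF T → (I ∖ K) ⊨ FT lem (impF T) I →
                I ⊨ impF (imp⊥ lem K (impPlus T))
  impF-reduct T nc I⊨T I∖K⊨T =
    impF-imp⊥ lem I K (impPlus T) (impF-impPlus lem I T I⊨T) body-avoids-K
    where
    body-avoids-K : ¬ Σ A (λ a → body T a × K a) →
                    I ⊨ impF (body T ⟶ disj⊥ K (disjPlus (head T)))
    body-avoids-K body∩K≡∅ I⊨body
      with FT-⇒⁻ lem (atomsF∧ (body T)) (disjF (head T)) I∖K⊨T
             (FT-atomsF∧⁺ lem proj₁ λ {a} a∈body →
               I⊨body (a , a∈body) , λ a∈K → body∩K≡∅ (a , a∈body , a∈K))
    ... | (l , l∈L) , I∖K⊨l = litF-reduct (head T) nc l l∈L I∖K⊨l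

lemma8 : (lem : LEM) {A : Set} (Π : SimpleProgram A) (I K : Interp A) →
         I ⊨ₚ Π →
         NoFLPCriticalIn Π K →
         I ⊨ₚ prog⊥ lem K (progPlus Π) →
         (I ∖ K) ⊨ₛ FTₚ lem Π I
lemma8 lem Π I K I⊨Π noFLP I⊨Π⁺⊥ i =
  FT-⇒⁺ lem (formF G) (atomsF∨ H) (I⊨Π i) λ I∖K⊨G → em⇒dne lem λ I∖K⊭H →
    let I⊨G                       = FT-sound lem (formF G) I∖K⊨G
        (p , p∈H) , p∈I           = I⊨Π i I⊨G
        p∈K                       = em⇒dne lem λ p∉K →
                                      I∖K⊭H (FT-atomsF∨⁺ lem proj₁ p∈H (p∈I , p∉K))
        nc                        = noFLPCritical⇒negneg∉K Π noFLP i p∈H p∈K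
        (p′ , p′∈H , p′∉K) , p′∈I = I⊨Π⁺⊥ i λ j →
                                      impF-reduct lem (term G j) (nc j) (I⊨G j) (I∖K⊨G j)
    in I∖K⊭H (FT-atomsF∨⁺ lem proj₁ p′∈H (p′∈I , p′∉K))
  where
  G = body (rule Π i)
  H = head (rule Π i)
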